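{- Every tree $z$ of positive degree is either $\underline{1}$, or prime, or the product $z=x\times y$ of exactly two prime trees $x,y$. Moreover, in the last case, writing $n=\deg z$, the factors are as follows: there is a proper divisor $d\ne1$ of $n$ and a tree $T\in Y_{d-1}$ with either $x=L_{n/d}$, $y=\underline{0}\vee T$, or $x=R_{n/d}$, $y=T\vee\underline{0}$.
   Context: A (planar binary) tree of degree $n$ is a rooted planar binary tree with $n$ trivalent internal vertices and $n+1$ leaves, drawn growing upward from its root, up to planar isotopy; $Y_n$ is the set of trees of degree $n$; $\underline{0}$, $\underline{1}$ are the unique trees of degree $0$, $1$. A grove of degree $n$ is a nonempty subset of $Y_n$; trees are identified with one-element groves. The graft $x\vee y$ attaches the root of $x$ to the left leaf and the root of $y$ to the right leaf of $\underline{1}$; each tree $x$ of positive degree is uniquely $x=x^l\vee x^r$. For $x\in Y_p,y\in Y_q$, $x/y\in Y_{p+q}$ identifies the root of $x$ with the leftmost leaf of $y$, and $x\backslash y$ identifies the rightmost leaf of $x$ with the root of $y$. $Y_n$ has the Tamari order generated by $(a\vee b)\vee c\le a\vee(b\vee c)$ and compatibility with grafting. Sum of trees: $x+y=\{z:x/y\le z\le x\backslash y\}$, extended to groves by unions over member trees. Left sum $x\dashv y=x^l\vee(x^r+y)$, right sum $x\vdash y=(x+y^l)\vee y^r$ (convention $x\vdash\underline{0}=\underline{0}\dashv y=\underline{0}$), extended to groves by unions. Product: for a tree $x$ of positive degree and grove $y$, $\underline{1}\times y=y$ and $x\times y=(x^l\times y)\vdash y\dashv(x^r\times y)$, omitting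 $(x^l\times y)\vdash$ when $x^l=\underline{0}$ and $\dashv(x^r\times y)$ when $x^r=\underline{0}$ (both parenthesizations agree); for groves $x$, $x\times y=\bigcup_i x_i\times y$. A grove is prime if it is not the product of two groves both different from $\underline{1}$. The primitive trees are $L_1=R_1=\underline{1}$, $L_n=L_{n-1}\vee\underline{0}$, $R_n=\underline{0}\vee R_{n-1}$ for $n>1$. -}

module Defs where

open import Data.Nat using (ℕ; zero; suc; _+_)
open import Data.Product using (Σ; ∃; ∃-syntax; _×_; _,_)
open import Relation.Binary.PropositionalEquality using (_≡_)
open import Relation.Nullary using (¬_)

-- Planar binary trees: leaf = the tree 0 (degree 0), l ∨ r = graft.
data Tree : Set where
  leaf : Tree
  _∨_  : Tree → Tree → Tree

infixr 6 _∨_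

-- degree = number of internal vertices; Y_n = { t | deg t ≡ n }
deg : Tree → ℕ
deg leaf    = 0
deg (l ∨ r) = suc (deg l + deg r)

one : Tree
one = leaf ∨ leaf

-- x / y : root of x identified with leftmost leaf of y
_over_ : Tree → Tree → Tree
x over leaf    = x
x over (l ∨ r) = (x over l) ∨ r

-- x \ y : rightmost leaf of x identified with root of y
_under_ : Tree → Tree → Tree
leaf    under y = y
(l ∨ r) under y = l ∨ (r under y)

data _≤T_ : Tree → Tree → Set where
  ≤T-refl  : ∀ {x} → x ≤T x
  ≤T-trans : ∀ {x y z} → x ≤T y → y ≤T z → x ≤T z
  ≤T-rot   : ∀ {a b c} → ((a ∨ b) ∨ c) ≤T (a ∨ (b ∨ c))
  ≤T-left  : ∀ {a a' b} → a ≤T a' → (a ∨ b) ≤T (a' ∨ b)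
  ≤T-right : ∀ {a b b'} → b ≤T b' → (a ∨ b) ≤T (a ∨ b')

TSet : Set₁
TSet = Tree → Set

⟦_⟧ : Tree → TSet
⟦ t ⟧ s = s ≡ t

IsGrove : TSet → Set
IsGrove G = (∃[ n ] (∀ t → G t → deg t ≡ n)) × (∃[ t ] G t)

_≐_ : TSet → TSet → Set
G ≐ H = ∀ t → (G t → H t) × (H t → G t)

treeSum : Tree → Tree → TSet
treeSum x y z = ((x over y) ≤T z) × (z ≤T (x under y))

leftSumT : Tree → Tree → TSet
leftSumT leaf    y z = z ≡ leaf
leftSumT (l ∨ r) y z = ∃[ w ] (treeSum r y w × z ≡ (l ∨ w))

rightSumT : Tree → Tree → TSet
rightSumT x leaf    z = z ≡ leaf
rightSumT x (l ∨ r) z = ∃[ w ] (treeSum x l w × z ≡ (w ∨ r))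

_⊣G_ : TSet → TSet → TSet
(X ⊣G Y) z = ∃[ x ] ∃[ y ] (X x × Y y × leftSumT x y z)

_⊢G_ : TSet → TSet → TSet
(X ⊢G Y) z = ∃[ x ] ∃[ y ] (X x × Y y × rightSumT x y z)

infixl 5 _⊣G_ _⊢G_

-- product of a tree with a grove:
--   1 × y = y,  x × y = (x^l × y) ⊢ y ⊣ (x^r × y) with the omissions;
--   parenthesised as ((x^l × y) ⊢ y) ⊣ (x^r × y).
-- Convention for degree 0 (not needed by the paper): 0 × y = {0}.
prodT : Tree → TSet → TSet
prodT leaf                  Y = ⟦ leaf ⟧
prodT (leaf ∨ leaf)         Y = Y
prodT (leaf ∨ (c ∨ d))      Y = Y ⊣G prodT (c ∨ d) Y
prodT ((a ∨ b) ∨ leaf)      Y = prodT (a ∨ b) Y ⊢G Y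
prodT ((a ∨ b) ∨ (c ∨ d))   Y = (prodT (a ∨ b) Y ⊢G Y) ⊣G prodT (c ∨ d) Y

_×G_ : TSet → TSet → TSet
(X ×G Y) z = ∃[ x ] (X x × prodT x Y z)

Prime : TSet → Set₁
Prime G = ¬ (Σ TSet λ A → Σ TSet λ B →
              IsGrove A × IsGrove B × ¬ (A ≐ ⟦ one ⟧) × ¬ (B ≐ ⟦ one ⟧) × ((A ×G B) ≐ G))

-- primitive trees L_n, R_n (n ≥ 1; L_0 = R_0 = 0 is a harmless extension)
L : ℕ → Tree
L zero    = leaf
L (suc n) = L n ∨ leaf

R : ℕ → Tree
R zero    = leaf
R (suc n) = leaf ∨ R n

-- A product a × b of trees is in general a grove with several members, because the
-- sums x + y in its definition are Tamari intervals [x/y, x\y], and these have two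
-- distinct ends as soon as x and y both have positive degree. Hence if a × b is a single
-- tree z, with a, b ≠ 0 and b ≠ 1, then every sum met while computing it must have a
-- trivial summand. Induction on a shows that this forces either a = 1, or b = 0 ∨ T,
-- a = L e and z is the left comb of e copies of T, or the mirror situation. So a tree that
-- is not such a comb is prime, and a comb factors as L e × (0 ∨ T) or R e × (T ∨ 0),
-- both factors being non-combs and hence prime.
module Submission where

open import Defs
open import Data.Nat using (ℕ; zero; suc; _*_; _∸_; _≤_; _<_; _+_; _≤?_; s≤s)
open import Data.Nat.Properties
open import Data.Nat.Tactic.RingSolver using (solve-∀)
open import Data.Product using (Σ; ∃; ∃-syntax; _×_; _,_; proj₁; proj₂)
open import Data.Sum using (_⊎_; inj₁; inj₂) renaming (map to ⊎-map)
open import Data.Empty using (⊥-elim)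
open import Function using (_∘_; id)
open import Relation.Nullary using (¬_; Dec; yes; no)
open import Relation.Nullary.Decidable using (map′; _×-dec_; _⊎-dec_; ¬?)
open import Relation.Unary using (_⊆_)
open import Relation.Binary.Definitions using (DecidableEquality)
open import Relation.Binary.PropositionalEquality
  using (_≡_; _≢_; refl; sym; trans; cong; cong₂; subst; module ≡-Reasoning)

left right : Tree → Tree
left leaf    = leaf
left (l ∨ _) = l
right leaf    = leaf
right (_ ∨ r) = r

_≟T_ : DecidableEquality Tree
leaf    ≟T leaf    = yes refl
leaf    ≟T (_ ∨ _) = no λ ()
(_ ∨ _) ≟T leaf    = no λ ()
(a ∨ b) ≟T (c ∨ d) with a ≟T c | b ≟T d
... | yes refl | yes refl = yes refl
... | no a≢c   | _        = no (a≢c ∘ cong left)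
... | yes _    | no b≢d   = no (b≢d ∘ cong right)

deg≡0⇒leaf : ∀ {t} → deg t ≡ 0 → t ≡ leaf
deg≡0⇒leaf {leaf} _ = refl

deg≡1⇒one : ∀ {t} → deg t ≡ 1 → t ≡ one
deg≡1⇒one {leaf ∨ leaf} _ = refl
deg≡1⇒one {leaf ∨ (_ ∨ _)} ()
deg≡1⇒one {(_ ∨ _) ∨ _} ()

leaf-over : ∀ y → leaf over y ≡ y
leaf-over leaf    = refl
leaf-over (l ∨ r) = cong (_∨ r) (leaf-over l)

under-leaf : ∀ x → x under leaf ≡ x
under-leaf leaf    = refl
under-leaf (l ∨ r) = cong (l ∨_) (under-leaf r)

deg-over : ∀ x y → deg (x over y) ≡ deg x + deg y
deg-over x leaf    = sym (+-identityʳ (deg x))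
deg-over x (l ∨ r) = begin
  suc (deg (x over l) + deg r)  ≡⟨ cong (λ n → suc (n + deg r)) (deg-over x l) ⟩
  suc (deg x + deg l + deg r)   ≡⟨ cong suc (+-assoc (deg x) (deg l) (deg r)) ⟩
  suc (deg x + (deg l + deg r)) ≡⟨ sym (+-suc (deg x) (deg l + deg r)) ⟩
  deg x + deg (l ∨ r)           ∎
  where open ≡-Reasoning

over≢under : ∀ {x y} → x ≢ leaf → y ≢ leaf → x over y ≢ x under y
over≢under {leaf}               x≢leaf _      _  = x≢leaf refl
over≢under {_ ∨ _}   {leaf}     _      y≢leaf _  = y≢leaf refl
over≢under {xl ∨ xr} {yl ∨ _}   _      _      eq =
  <-irrefl (cong (deg ∘ left) (sym eq)) deg-xl<
  where
  open ≤-Reasoning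
  deg-xl< : deg xl < deg ((xl ∨ xr) over yl)
  deg-xl< = begin-strict
    deg xl                         <⟨ s≤s (m≤m+n (deg xl) (deg xr)) ⟩
    deg (xl ∨ xr)                  ≤⟨ m≤m+n _ (deg yl) ⟩
    deg (xl ∨ xr) + deg yl         ≡⟨ sym (deg-over (xl ∨ xr) yl) ⟩
    deg ((xl ∨ xr) over yl)        ∎

≡⇒≤T : ∀ {x y} → x ≡ y → x ≤T y
≡⇒≤T refl = ≤T-refl

≤T-deg : ∀ {x y} → x ≤T y → deg x ≡ deg y
≤T-deg ≤T-refl                  = refl
≤T-deg (≤T-trans p q)           = trans (≤T-deg p) (≤T-deg q)
≤T-deg (≤T-rot {a} {b} {c})     = cong suc (trans (cong suc (+-assoc (deg a) (deg b) (deg c)))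
                                                   (sym (+-suc (deg a) (deg b + deg c))))
≤T-deg (≤T-left {b = b} p)      = cong (λ n → suc (n + deg b)) (≤T-deg p)
≤T-deg (≤T-right {a = a} p)     = cong (λ n → suc (deg a + n)) (≤T-deg p)

-- Sum over the internal vertices of the degree of their right subtree: each rotation
-- (a ∨ b) ∨ c ↦ a ∨ (b ∨ c) raises it by 1 + deg c, so it is a strict potential.
rightWeight : Tree → ℕ
rightWeight leaf    = 0
rightWeight (l ∨ r) = rightWeight l + rightWeight r + deg r

rightWeight-rot : ∀ a b c → rightWeight ((a ∨ b) ∨ c) < rightWeight (a ∨ (b ∨ c))
rightWeight-rot a b c =
  subst (rightWeight ((a ∨ b) ∨ c) <_)
        (sym (identity (rightWeight a) (rightWeight b) (rightWeight c) (deg b) (deg c)))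
        (s≤s (m≤n+m _ (deg c)))
  where
  identity : ∀ A B C D E → A + (B + C + E) + suc (D + E) ≡ suc (E + (A + B + D + C + E))
  identity = solve-∀

≤T⇒≡⊎rightWeight< : ∀ {x y} → x ≤T y → x ≡ y ⊎ rightWeight x < rightWeight y
≤T⇒≡⊎rightWeight< ≤T-refl = inj₁ refl
≤T⇒≡⊎rightWeight< (≤T-trans p q) with ≤T⇒≡⊎rightWeight< p | ≤T⇒≡⊎rightWeight< q
... | inj₁ refl | q′        = q′
... | inj₂ lt   | inj₁ refl = inj₂ lt
... | inj₂ lt   | inj₂ lt′  = inj₂ (<-trans lt lt′)
≤T⇒≡⊎rightWeight< (≤T-rot {a} {b} {c}) = inj₂ (rightWeight-rot a b c)
≤T⇒≡⊎rightWeight< (≤T-left {b = b} p) =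
  ⊎-map (cong (_∨ b)) (+-monoˡ-< (deg b) ∘ +-monoˡ-< (rightWeight b)) (≤T⇒≡⊎rightWeight< p)
≤T⇒≡⊎rightWeight< (≤T-right {a = a} {b} {b′} p) =
  ⊎-map (cong (a ∨_))
        (λ lt → subst (λ n → _ < rightWeight a + rightWeight b′ + n) (≤T-deg p)
                      (+-monoˡ-< (deg b) (+-monoʳ-< (rightWeight a) lt)))
        (≤T⇒≡⊎rightWeight< p)

≤T-antisym : ∀ {x y} → x ≤T y → y ≤T x → x ≡ y
≤T-antisym p q with ≤T⇒≡⊎rightWeight< p | ≤T⇒≡⊎rightWeight< q
... | inj₁ x≡y | _        = x≡y
... | _        | inj₁ y≡x = sym y≡x
... | inj₂ lt  | inj₂ gt  = ⊥-elim (<-asym lt gt)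

under∨≤under : ∀ x l r → ((x under l) ∨ r) ≤T (x under (l ∨ r))
under∨≤under leaf    l r = ≤T-refl
under∨≤under (a ∨ b) l r = ≤T-trans ≤T-rot (≤T-right (under∨≤under b l r))

over≤under : ∀ x y → (x over y) ≤T (x under y)
over≤under x leaf    = ≡⇒≤T (sym (under-leaf x))
over≤under x (l ∨ r) = ≤T-trans (≤T-left (over≤under x l)) (under∨≤under x l r)

over∈sum : ∀ x y → treeSum x y (x over y)
over∈sum x y = ≤T-refl , over≤under x y

under∈sum : ∀ x y → treeSum x y (x under y)
under∈sum x y = over≤under x y , ≤T-refl

sum-leafˡ : ∀ {y} → treeSum leaf y ≐ ⟦ y ⟧
sum-leafˡ {y} t = (λ (p , q) → ≤T-antisym q (subst (_≤T t) (leaf-over y) p))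
                , λ { refl → ≡⇒≤T (leaf-over y) , ≤T-refl }

sum-leafʳ : ∀ {x} → treeSum x leaf ≐ ⟦ x ⟧
sum-leafʳ {x} t = (λ (p , q) → ≤T-antisym (subst (t ≤T_) (under-leaf x) q) p)
                , λ { refl → ≤T-refl , ≡⇒≤T (sym (under-leaf x)) }

sum⊆⟦⟧⇒leaf : ∀ {x y z} → treeSum x y ⊆ ⟦ z ⟧ → x ≡ leaf ⊎ y ≡ leaf
sum⊆⟦⟧⇒leaf {leaf}          _ = inj₁ refl
sum⊆⟦⟧⇒leaf {_ ∨ _} {leaf}  _ = inj₂ refl
sum⊆⟦⟧⇒leaf {x@(_ ∨ _)} {y@(_ ∨ _)} H =
  ⊥-elim (over≢under {x} {y} (λ ()) (λ ()) (trans (H (over∈sum x y)) (sym (H (under∈sum x y)))))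

leftSum-member : ∀ x y → ∃ (leftSumT x y)
leftSum-member leaf    y = leaf , refl
leftSum-member (l ∨ r) y = l ∨ (r over y) , r over y , over∈sum r y , refl

rightSum-member : ∀ x y → ∃ (rightSumT x y)
rightSum-member x leaf    = leaf , refl
rightSum-member x (l ∨ r) = (x over l) ∨ r , x over l , over∈sum x l , refl

leftSum-leafʳ : ∀ {l y} → leftSumT (l ∨ leaf) y ≐ ⟦ l ∨ y ⟧
leftSum-leafʳ {l} t = (λ { (w , s , refl) → cong (l ∨_) (proj₁ (sum-leafˡ w) s) })
                    , λ { refl → _ , proj₂ (sum-leafˡ _) refl , refl }

rightSum-leafˡ : ∀ {x r} → rightSumT x (leaf ∨ r) ≐ ⟦ x ∨ r ⟧
rightSum-leafˡ {r = r} t = (λ { (w , s , refl) → cong (_∨ r) (proj₁ (sum-leafʳ w) s) })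
                         , λ { refl → _ , proj₂ (sum-leafʳ _) refl , refl }

leftSums⊆⟦⟧ : ∀ {P : TSet} {l r z y₀} → P y₀ → y₀ ≢ leaf →
  (∀ {y} → P y → leftSumT (l ∨ r) y ⊆ ⟦ z ⟧) →
  r ≡ leaf × ∃[ z′ ] (z ≡ l ∨ z′ × P ⊆ ⟦ z′ ⟧)
leftSums⊆⟦⟧ {P} {l} {r} {z} Py₀ y₀≢leaf H
  with sum⊆⟦⟧⇒leaf (λ s → cong right (H Py₀ (_ , s , refl)))
... | inj₂ y₀≡leaf = ⊥-elim (y₀≢leaf y₀≡leaf)
... | inj₁ refl    = refl , _ , sym (grafted Py₀)
                   , λ Py → cong right (trans (grafted Py) (sym (grafted Py₀)))
  where
  grafted : ∀ {y} → P y → l ∨ y ≡ z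
  grafted Py = H Py (proj₂ (leftSum-leafʳ _) refl)

rightSums⊆⟦⟧ : ∀ {P : TSet} {l r z x₀} → P x₀ → x₀ ≢ leaf →
  (∀ {x} → P x → rightSumT x (l ∨ r) ⊆ ⟦ z ⟧) →
  l ≡ leaf × ∃[ z′ ] (z ≡ z′ ∨ r × P ⊆ ⟦ z′ ⟧)
rightSums⊆⟦⟧ {P} {l} {r} {z} Px₀ x₀≢leaf H
  with sum⊆⟦⟧⇒leaf (λ s → cong left (H Px₀ (_ , s , refl)))
... | inj₁ x₀≡leaf = ⊥-elim (x₀≢leaf x₀≡leaf)
... | inj₂ refl    = refl , _ , sym (grafted Px₀)
                   , λ Px → cong left (trans (grafted Px) (sym (grafted Px₀)))
  where
  grafted : ∀ {x} → P x → x ∨ r ≡ z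
  grafted Px = H Px (proj₂ (rightSum-leafˡ _) refl)

⊣G-mono : ∀ {X X′ Y Y′ : TSet} → X ⊆ X′ → Y ⊆ Y′ → (X ⊣G Y) ⊆ (X′ ⊣G Y′)
⊣G-mono X⊆ Y⊆ (x , y , Xx , Yy , s) = x , y , X⊆ Xx , Y⊆ Yy , s

⊢G-mono : ∀ {X X′ Y Y′ : TSet} → X ⊆ X′ → Y ⊆ Y′ → (X ⊢G Y) ⊆ (X′ ⊢G Y′)
⊢G-mono X⊆ Y⊆ (x , y , Xx , Yy , s) = x , y , X⊆ Xx , Y⊆ Yy , s

prodT-mono : ∀ a {Y Y′ : TSet} → Y ⊆ Y′ → prodT a Y ⊆ prodT a Y′
prodT-mono leaf                      _  p = p
prodT-mono (leaf ∨ leaf)             Y⊆ p = Y⊆ p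
prodT-mono (leaf ∨ c@(_ ∨ _))        Y⊆ p = ⊣G-mono Y⊆ (prodT-mono c Y⊆) p
prodT-mono (c@(_ ∨ _) ∨ leaf)        Y⊆ p = ⊢G-mono (prodT-mono c Y⊆) Y⊆ p
prodT-mono (c@(_ ∨ _) ∨ d@(_ ∨ _))   Y⊆ p =
  ⊣G-mono (⊢G-mono (prodT-mono c Y⊆) Y⊆) (prodT-mono d Y⊆) p

prodT-member : ∀ a b → ∃ (prodT a ⟦ b ⟧)
prodT-member leaf                    b = leaf , refl
prodT-member (leaf ∨ leaf)           b = b , refl
prodT-member (leaf ∨ c@(_ ∨ _))      b =
  let y , Py = prodT-member c b
      t , s  = leftSum-member b y
  in t , b , y , refl , Py , s
prodT-member (c@(_ ∨ _) ∨ leaf)      b =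
  let x , Px = prodT-member c b
      t , s  = rightSum-member x b
  in t , x , b , Px , refl , s
prodT-member (c@(_ ∨ _) ∨ d@(_ ∨ _)) b =
  let x , Px = prodT-member c b
      u , s  = rightSum-member x b
      y , Py = prodT-member d b
      t , s′ = leftSum-member u y
  in t , u , y , (x , b , Px , refl , s) , Py , s′

prodT-leafʳ : ∀ a → prodT a ⟦ leaf ⟧ ⊆ ⟦ leaf ⟧
prodT-leafʳ leaf                    refl = refl
prodT-leafʳ (leaf ∨ leaf)           refl = refl
prodT-leafʳ (leaf ∨ (_ ∨ _))        (_ , _ , refl , _ , t≡leaf) = t≡leaf
prodT-leafʳ ((_ ∨ _) ∨ leaf)        (_ , _ , _ , refl , t≡leaf) = t≡leaf
prodT-leafʳ ((_ ∨ _) ∨ (_ ∨ _))     (_ , _ , (_ , _ , _ , refl , refl) , _ , t≡leaf) = t≡leaf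

prodT-nonleaf : ∀ a {bl br t} → a ≢ leaf → prodT a ⟦ bl ∨ br ⟧ t → t ≢ leaf
prodT-nonleaf leaf                a≢leaf _ = ⊥-elim (a≢leaf refl)
prodT-nonleaf (leaf ∨ leaf)       _ refl ()
prodT-nonleaf (leaf ∨ (_ ∨ _))    _ (_ , _ , refl , _ , _ , _ , refl) ()
prodT-nonleaf ((_ ∨ _) ∨ leaf)    _ (_ , _ , _ , refl , _ , _ , refl) ()
prodT-nonleaf ((_ ∨ _) ∨ (_ ∨ _)) _ (_ , _ , (_ , _ , _ , refl , _ , _ , refl) , _ , _ , _ , refl) ()

lcomb rcomb : ℕ → Tree → Tree
lcomb zero    T = leaf
lcomb (suc e) T = lcomb e T ∨ T
rcomb zero    T = leaf
rcomb (suc e) T = T ∨ rcomb e T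

deg-lcomb : ∀ e T → deg (lcomb e T) ≡ e * suc (deg T)
deg-lcomb zero    T = refl
deg-lcomb (suc e) T = cong suc (trans (cong (_+ deg T) (deg-lcomb e T)) (+-comm _ (deg T)))

deg-rcomb : ∀ e T → deg (rcomb e T) ≡ e * suc (deg T)
deg-rcomb zero    T = refl
deg-rcomb (suc e) T = cong (λ n → suc (deg T + n)) (deg-rcomb e T)

IsLComb IsRComb IsComb : Tree → Set
IsLComb z = Σ ℕ λ e → Σ Tree λ T → 2 ≤ e × T ≢ leaf × z ≡ lcomb e T
IsRComb z = Σ ℕ λ e → Σ Tree λ T → 2 ≤ e × T ≢ leaf × z ≡ rcomb e T
IsComb z = IsLComb z ⊎ IsRComb z

-- z = L e × b with b = 0 ∨ T, or z = R e × b with b = T ∨ 0, for some e ≥ 2.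
CombOn : Tree → Tree → Set
CombOn b z = Σ ℕ λ e → Σ Tree λ T → 2 ≤ e ×
  ((b ≡ leaf ∨ T × z ≡ lcomb e T) ⊎ (b ≡ T ∨ leaf × z ≡ rcomb e T))

combOn⇒isComb : ∀ {b z} → b ≢ one → CombOn b z → IsComb z
combOn⇒isComb b≢one (e , T , 2≤e , inj₁ (refl , z≡)) =
  inj₁ (e , T , 2≤e , b≢one ∘ cong (leaf ∨_) , z≡)
combOn⇒isComb b≢one (e , T , 2≤e , inj₂ (refl , z≡)) =
  inj₂ (e , T , 2≤e , b≢one ∘ cong (_∨ leaf) , z≡)

¬isComb-∨leaf : ∀ t → ¬ IsComb (t ∨ leaf)
¬isComb-∨leaf t (inj₁ (suc _ , _ , _ , T≢leaf , refl)) = T≢leaf refl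
¬isComb-∨leaf t (inj₂ (suc zero , _ , s≤s () , _))
¬isComb-∨leaf t (inj₂ (suc (suc _) , _ , _ , _ , ()))

¬isComb-leaf∨ : ∀ t → ¬ IsComb (leaf ∨ t)
¬isComb-leaf∨ t (inj₁ (suc zero , _ , s≤s () , _))
¬isComb-leaf∨ t (inj₁ (suc (suc _) , _ , _ , _ , ()))
¬isComb-leaf∨ t (inj₂ (suc _ , _ , _ , T≢leaf , refl)) = T≢leaf refl

-- Deciding combs: the number of teeth of a left comb is the length of its left spine.

leftSpine rightSpine : Tree → ℕ
leftSpine leaf    = 0
leftSpine (l ∨ _) = suc (leftSpine l)
rightSpine leaf    = 0
rightSpine (_ ∨ r) = suc (rightSpine r)

leftSpine-lcomb : ∀ e T → leftSpine (lcomb e T) ≡ e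
leftSpine-lcomb zero    T = refl
leftSpine-lcomb (suc e) T = cong suc (leftSpine-lcomb e T)

rightSpine-rcomb : ∀ e T → rightSpine (rcomb e T) ≡ e
rightSpine-rcomb zero    T = refl
rightSpine-rcomb (suc e) T = cong suc (rightSpine-rcomb e T)

isLComb⇒spine : ∀ {z} → IsLComb z →
  2 ≤ leftSpine z × right z ≢ leaf × z ≡ lcomb (leftSpine z) (right z)
isLComb⇒spine (suc e , T , 2≤e , T≢leaf , refl)
  rewrite leftSpine-lcomb e T = 2≤e , T≢leaf , refl

isRComb⇒spine : ∀ {z} → IsRComb z →
  2 ≤ rightSpine z × left z ≢ leaf × z ≡ rcomb (rightSpine z) (left z)
isRComb⇒spine (suc e , T , 2≤e , T≢leaf , refl)
  rewrite rightSpine-rcomb e T = 2≤e , T≢leaf , refl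

isComb? : ∀ z → Dec (IsComb z)
isComb? z = isLComb? ⊎-dec isRComb?
  where
  isLComb? : Dec (IsLComb z)
  isLComb? = map′ (λ (2≤e , T≢leaf , z≡) → leftSpine z , right z , 2≤e , T≢leaf , z≡)
                  isLComb⇒spine
                  (2 ≤? leftSpine z ×-dec ¬? (right z ≟T leaf)
                    ×-dec z ≟T lcomb (leftSpine z) (right z))
  isRComb? : Dec (IsRComb z)
  isRComb? = map′ (λ (2≤e , T≢leaf , z≡) → rightSpine z , left z , 2≤e , T≢leaf , z≡)
                  isRComb⇒spine
                  (2 ≤? rightSpine z ×-dec ¬? (left z ≟T leaf)
                    ×-dec z ≟T rcomb (rightSpine z) (left z))

combOn-extendʳ : ∀ {bl z′} → bl ∨ leaf ≢ one →
  z′ ≡ bl ∨ leaf ⊎ CombOn (bl ∨ leaf) z′ → CombOn (bl ∨ leaf) (bl ∨ z′)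
combOn-extendʳ {bl} _ (inj₁ refl) = 2 , bl , ≤-refl , inj₂ (refl , refl)
combOn-extendʳ b≢one (inj₂ (_ , _ , _ , inj₁ (refl , _))) = ⊥-elim (b≢one refl)
combOn-extendʳ _ (inj₂ (e , T , 2≤e , inj₂ (refl , refl))) =
  suc e , T , m≤n⇒m≤1+n 2≤e , inj₂ (refl , refl)

combOn-extendˡ : ∀ {br z′} → leaf ∨ br ≢ one →
  z′ ≡ leaf ∨ br ⊎ CombOn (leaf ∨ br) z′ → CombOn (leaf ∨ br) (z′ ∨ br)
combOn-extendˡ {br} _ (inj₁ refl) = 2 , br , ≤-refl , inj₁ (refl , refl)
combOn-extendˡ b≢one (inj₂ (_ , _ , _ , inj₂ (refl , _))) = ⊥-elim (b≢one refl)
combOn-extendˡ _ (inj₂ (e , T , 2≤e , inj₁ (refl , refl))) =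
  suc e , T , m≤n⇒m≤1+n 2≤e , inj₁ (refl , refl)

singleton-product : ∀ a {bl br z} → a ≢ leaf → bl ∨ br ≢ one →
  prodT a ⟦ bl ∨ br ⟧ ⊆ ⟦ z ⟧ → (a ≡ one × z ≡ bl ∨ br) ⊎ CombOn (bl ∨ br) z
singleton-product leaf a≢leaf _ _ = ⊥-elim (a≢leaf refl)
singleton-product (leaf ∨ leaf) _ _ H = inj₁ (refl , sym (H refl))
singleton-product (leaf ∨ c@(_ ∨ _)) {bl} {br} _ b≢one H
  with leftSums⊆⟦⟧ Py₀ (prodT-nonleaf c (λ ()) Py₀) (λ Py s → H (_ , _ , refl , Py , s))
  where Py₀ = proj₂ (prodT-member c (bl ∨ br))
... | refl , _ , refl , P⊆ =
  inj₂ (combOn-extendʳ b≢one (⊎-map proj₂ id (singleton-product c (λ ()) b≢one P⊆)))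
singleton-product (c@(_ ∨ _) ∨ leaf) {bl} {br} _ b≢one H
  with rightSums⊆⟦⟧ Px₀ (prodT-nonleaf c (λ ()) Px₀) (λ Px s → H (_ , _ , Px , refl , s))
  where Px₀ = proj₂ (prodT-member c (bl ∨ br))
... | refl , _ , refl , P⊆ =
  inj₂ (combOn-extendˡ b≢one (⊎-map proj₂ id (singleton-product c (λ ()) b≢one P⊆)))
singleton-product (c@(_ ∨ _) ∨ d@(_ ∨ _)) {bl} {br} {z} _ b≢one H =
  ⊥-elim (b≢one (cong₂ _∨_ bl≡leaf br≡leaf))
  where
  u₀  = proj₁ (prodT-member c (bl ∨ br))
  Pu₀ = proj₂ (prodT-member c (bl ∨ br))
  Pv₀ = proj₂ (prodT-member d (bl ∨ br))
  -- Each w ∈ u₀ + bl yields the members (w ∨ br) ⊣ y, y ∈ d × b, of the product.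
  through : ∀ {w} → treeSum u₀ bl w →
            br ≡ leaf × ∃[ z′ ] (z ≡ w ∨ z′ × prodT d ⟦ bl ∨ br ⟧ ⊆ ⟦ z′ ⟧)
  through s = leftSums⊆⟦⟧ Pv₀ (prodT-nonleaf d (λ ()) Pv₀)
                (λ Py t → H (_ , _ , (u₀ , _ , Pu₀ , refl , _ , s , refl) , Py , t))
  br≡leaf : br ≡ leaf
  br≡leaf = proj₁ (through (over∈sum u₀ bl))
  bl≡leaf : bl ≡ leaf
  bl≡leaf with sum⊆⟦⟧⇒leaf (λ s → let _ , _ , z≡ , _ = through s in cong left (sym z≡))
  ... | inj₁ u₀≡leaf = ⊥-elim (prodT-nonleaf c (λ ()) Pu₀ u₀≡leaf)
  ... | inj₂ bl≡leaf = bl≡leaf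

grove∋one⇒≐one : ∀ {A} → IsGrove A → A one → A ≐ ⟦ one ⟧
grove∋one⇒≐one ((_ , deg≡n) , _) A-one t =
    (λ At → deg≡1⇒one (trans (deg≡n t At) (sym (deg≡n one A-one))))
  , λ { refl → A-one }

singleton-product⇒unit : ∀ {z} → z ≢ leaf → ¬ IsComb z →
  ∀ a b → prodT a ⟦ b ⟧ ⊆ ⟦ z ⟧ → a ≡ one ⊎ b ≡ one
singleton-product⇒unit z≢leaf _ leaf _ H = ⊥-elim (z≢leaf (sym (H refl)))
singleton-product⇒unit z≢leaf _ a@(_ ∨ _) leaf H =
  let t , Pt = prodT-member a leaf in ⊥-elim (z≢leaf (trans (sym (H Pt)) (prodT-leafʳ a Pt)))
singleton-product⇒unit _ ¬comb a@(_ ∨ _) b@(_ ∨ _) H with b ≟T one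
... | yes b≡one = inj₂ b≡one
... | no b≢one with singleton-product a (λ ()) b≢one H
...   | inj₁ (a≡one , _) = inj₁ a≡one
...   | inj₂ comb        = ⊥-elim (¬comb (combOn⇒isComb b≢one comb))

prime-if-¬isComb : ∀ {z} → z ≢ leaf → ¬ IsComb z → Prime ⟦ z ⟧
prime-if-¬isComb z≢leaf ¬comb
  (A , B , A-grove@(_ , a , Aa) , B-grove@(_ , b , Bb) , A≢one , B≢one , AB≐z)
  with singleton-product⇒unit z≢leaf ¬comb a b
         (λ Pt → proj₁ (AB≐z _) (a , Aa , prodT-mono a (λ { refl → Bb }) Pt))
... | inj₁ refl = A≢one (grove∋one⇒≐one A-grove Aa)
... | inj₂ refl = B≢one (grove∋one⇒≐one B-grove Bb)

≐-trans : ∀ {X Y Z : TSet} → X ≐ Y → Y ≐ Z → X ≐ Z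
≐-trans X≐Y Y≐Z t = proj₁ (Y≐Z t) ∘ proj₁ (X≐Y t) , proj₂ (X≐Y t) ∘ proj₂ (Y≐Z t)

×G-⟦⟧ˡ : ∀ x Y → (⟦ x ⟧ ×G Y) ≐ prodT x Y
×G-⟦⟧ˡ x Y t = (λ { (_ , refl , p) → p }) , λ p → x , refl , p

prodT-L : ∀ k T → prodT (L (suc k)) ⟦ leaf ∨ T ⟧ ≐ ⟦ lcomb (suc k) T ⟧
prodT-L zero    T t = id , id
prodT-L (suc k) T t =
    (λ { (x , _ , Px , refl , s) →
           trans (proj₁ (rightSum-leafˡ t) s) (cong (_∨ T) (proj₁ (prodT-L k T x) Px)) })
  , λ { refl → lcomb (suc k) T , leaf ∨ T , proj₂ (prodT-L k T _) refl , refl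
             , proj₂ (rightSum-leafˡ _) refl }

prodT-R : ∀ k T → prodT (R (suc k)) ⟦ T ∨ leaf ⟧ ≐ ⟦ rcomb (suc k) T ⟧
prodT-R zero    T t = id , id
prodT-R (suc k) T t =
    (λ { (_ , y , refl , Py , s) →
           trans (proj₁ (leftSum-leafʳ t) s) (cong (T ∨_) (proj₁ (prodT-R k T y) Py)) })
  , λ { refl → T ∨ leaf , rcomb (suc k) T , refl , proj₂ (prodT-R k T _) refl
             , proj₂ (leftSum-leafʳ _) refl }

suc-deg≢1 : ∀ {T} → T ≢ leaf → suc (deg T) ≢ 1
suc-deg≢1 T≢leaf = T≢leaf ∘ deg≡0⇒leaf ∘ suc-injective

mainTheorem4 : (z : Tree) → 1 ≤ deg z →
    (z ≡ one)
    ⊎ Prime ⟦ z ⟧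
    ⊎ (Σ Tree λ x → Σ Tree λ y →
         Prime ⟦ x ⟧ × Prime ⟦ y ⟧ × ((⟦ x ⟧ ×G ⟦ y ⟧) ≐ ⟦ z ⟧)
         × (∃[ d ] ∃[ e ] ((e * d ≡ deg z) × (d ≢ 1) × (e ≢ 1)
              × (∃[ T ] ((deg T ≡ d ∸ 1)
                   × (((x ≡ L e) × (y ≡ (leaf ∨ T)))
                      ⊎ ((x ≡ R e) × (y ≡ (T ∨ leaf)))))))))
mainTheorem4 leaf ()
mainTheorem4 z@(_ ∨ _) _ with isComb? z
... | no ¬comb = inj₂ (inj₁ (prime-if-¬isComb (λ ()) ¬comb))
... | yes (inj₁ (suc k , T , 2≤e , T≢leaf , refl)) =
  inj₂ (inj₂ (L (suc k) , leaf ∨ T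
    , prime-if-¬isComb (λ ()) (¬isComb-∨leaf (L k)) , prime-if-¬isComb (λ ()) (¬isComb-leaf∨ T)
    , ≐-trans (×G-⟦⟧ˡ (L (suc k)) _) (prodT-L k T)
    , suc (deg T) , suc k , sym (deg-lcomb (suc k) T) , suc-deg≢1 T≢leaf , >⇒≢ 2≤e
    , T , refl , inj₁ (refl , refl)))
... | yes (inj₂ (suc k , T , 2≤e , T≢leaf , refl)) =
  inj₂ (inj₂ (R (suc k) , T ∨ leaf
    , prime-if-¬isComb (λ ()) (¬isComb-leaf∨ (R k)) , prime-if-¬isComb (λ ()) (¬isComb-∨leaf T)
    , ≐-trans (×G-⟦⟧ˡ (R (suc k)) _) (prodT-R k T)
    , suc (deg T) , suc k , sym (deg-rcomb (suc k) T) , suc-deg≢1 T≢leaf , >⇒≢ 2≤e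
    , T , refl , inj₂ (refl , refl)))
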